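{- Run algorithm Tight-VC-HC on an instance of VC-HC admitting a feasible assignment, with maximum edge size $f\ge2$, and let $k$ be the number of iterations of Step 2. Let $\mathcal E^{(k)}$ be the edge set $\mathcal E$ during the last iteration, $(\mathbf x^{(k)},\mathbf h^{(k)})$ the basic optimal solution computed in the last iteration, and $\mathbf h'$ the final $\{0,1\}$-assignment for folded edges. Define $\tilde h_{e,v}:=h^{(k)}_{e,v}$ for $e\in\mathcal E^{(k)}$, $v\in e$, and $\tilde h_{e,v}:=h'_{e,v}$ for $e\in E\setminus\mathcal E^{(k)}$, $v\in e$. Then $(\lceil\mathbf x^{(k)}\rceil,\tilde{\mathbf h})$ is feasible for $\mathrm{LP}(E,\mathbf 0,\mathbf c)$.
   Context: VC-HC: a hypergraph $G=(V,E)$ with $E\subseteq 2^V$, $f:=\max_{e\in E}|e|$; demands $d_e\ge0$, capacities $c_v\ge0$, integer multiplicities $m_v\ge0$. An assignment $h$ with $h_{e,v}\ge0$ ($e\in E,v\in e$) is feasible if $\sum_{v\in e}h_{e,v}=1$ for all $e$ and $\lceil\sum_{e\ni v}d_eh_{e,v}/c_v\rceil\le m_v$ for all $v$. $\lceil\mathbf x\rceil$ denotes componentwise ceiling. For $E'\subseteq E$, $\mathbf0\le\boldsymbol\ell\le\mathbf m$ and capacities $\mathbf c'$, $\mathrm{LP}(E',\boldsymbol\ell,\mathbf c')$ minimizes $\sum_{v\in V}x_v$ subject to: $\sum_{v\in e}h_{e,v}=1$ ($e\in E'$); $\sum_{e\in E',\,v\in e}d_eh_{e,v}\le c'_vx_v$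 ($v\in V$); $\ell_v\le x_v\le m_v$ ($v\in V$); $0\le h_{e,v}\le x_v$ ($e\in E'$, $v\in e$). A basic optimal solution is an optimal extreme point of the feasible region. Algorithm Tight-VC-HC. Step 1: set $\mathcal E:=E$, $h'_{e,v}:=0$, $\ell_v:=0$, $c'_v:=c_v$. Step 2: repeat: (a) solve $\mathrm{LP}(\mathcal E,\boldsymbol\ell,\mathbf c')$ for a basic optimal solution $(\mathbf x,\mathbf h)$; (b) $I:=\{v:0<x_v<1/f\}$; (c) for $e\in\mathcal E$, $T(e):=\{v\in e\setminus I:0<h_{e,v}=x_v\}$; (d) if all $T(e)$ are empty go to Step 3; (e) for each $e\in\mathcal E$ with $T(e)\ne\emptyset$: pick an arbitrary $v\in T(e)$ and set $h'_{e,v}:=1$; for all $v\in T(e)$ decrease $c'_v$ by $d_e$ and set $\ell_v:=x_v$; remove $e$ from $\mathcal E$. Step 3: output $x^*_v:=\lceil x_v\rceil$ and $h^*_{e,v}:=h_{e,v}$ if $e\in\mathcal E$, $h^*_{e,v}:=h'_{e,v}$ otherwise (using the last iteration's values).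
   Formalization: The demands $d_e$, the capacities $c_v$, the assumed feasible assignment and all LP solutions, including the basic optimal ones of Step 2, are rational, with extreme points and optimality taken among rational points. -}

module Defs where

open import Data.Nat as ℕ using (ℕ; zero; suc; _⊔_)
open import Data.Integer as ℤ using (ℤ; +_)
open import Data.Rational as ℚ using (ℚ; 0ℚ; 1ℚ; _+_; _*_; _-_; _≤_; _<_; _÷_; ≢-nonZero)
  renaming (ceiling to ⌈_⌉)
open import Data.Rational.Properties using (_≟_; _<?_)
open import Data.Fin as Fin using (Fin)
import Data.Fin.Properties as FinP
open import Data.Fin.Subset using (Subset; ∣_∣)
open import Data.Vec using (lookup)
open import Data.Bool using (Bool; true; false; _∧_; not; if_then_else_; _∨_)
open import Data.Product using (_×_; Σ; ∃)
open import Relation.Nullary using (¬_; does; yes; no)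
open import Relation.Binary.PropositionalEquality using (_≡_)
open import Function using (_∘_)

sumFin : ∀ {k} → (Fin k → ℚ) → ℚ
sumFin {zero}  g = 0ℚ
sumFin {suc k} g = g Fin.zero + sumFin (g ∘ Fin.suc)

maxFin : ∀ {k} → (Fin k → ℕ) → ℕ
maxFin {zero}  g = 0
maxFin {suc k} g = g Fin.zero ⊔ maxFin (g ∘ Fin.suc)

anyFin : ∀ {k} → (Fin k → Bool) → Bool
anyFin {zero}  g = false
anyFin {suc k} g = g Fin.zero ∨ anyFin (g ∘ Fin.suc)

ℕtoℚ : ℕ → ℚ
ℕtoℚ k = ℚ._/_ (+ k) 1

ℤtoℚ : ℤ → ℚ
ℤtoℚ z = ℚ._/_ z 1

-- 1/f (the value at f = 0 is irrelevant; the theorem assumes f ≥ 2)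
invℕ : ℕ → ℚ
invℕ zero    = 0ℚ
invℕ (suc k) = ℚ._/_ (+ 1) (suc k)

ind : Bool → ℚ → ℚ
ind b q = if b then q else 0ℚ

-- A VC-HC instance: vertices Fin n, edges indexed by Fin m
-- (edge e ⊆ V given as a Subset n), demands d, capacities c,
-- multiplicities mult.

module VCHC (n m : ℕ) (edge : Fin m → Subset n)
            (d : Fin m → ℚ) (c : Fin n → ℚ) (mult : Fin n → ℕ) where

  mem : Fin m → Fin n → Bool
  mem e v = lookup (edge e) v

  f : ℕ
  f = maxFin (λ e → ∣ edge e ∣)

  load : (Fin m → Bool) → (Fin m → Fin n → ℚ) → Fin n → ℚ
  load Eb h v = sumFin (λ e → ind (Eb e ∧ mem e v) (d e * h e v))

  -- ⌈ L / c_v ⌉ ≤ m_v ; for c_v = 0 the quotient is read as requiring L ≤ 0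
  capOK : Fin n → ℚ → Set
  capOK v L with c v ≟ 0ℚ
  ... | yes _  = L ≤ 0ℚ
  ... | no c≢0 = ⌈ _÷_ L (c v) {{≢-nonZero c≢0}} ⌉ ℤ.≤ + mult v

  allE : Fin m → Bool
  allE _ = true

  FeasibleAssignment : (Fin m → Fin n → ℚ) → Set
  FeasibleAssignment h =
      (∀ e v → mem e v ≡ true → 0ℚ ≤ h e v)
    × (∀ e → sumFin (λ v → ind (mem e v) (h e v)) ≡ 1ℚ)
    × (∀ v → capOK v (load allE h v))

  -- (x , h) satisfies the constraints of LP(E', ℓ, c'), E' given by Eb
  LPFeasible : (Eb : Fin m → Bool) (ℓ c' : Fin n → ℚ)
               (x : Fin n → ℚ) (h : Fin m → Fin n → ℚ) → Set
  LPFeasible Eb ℓ c' x h =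
      (∀ e → Eb e ≡ true → sumFin (λ v → ind (mem e v) (h e v)) ≡ 1ℚ)
    × (∀ v → load Eb h v ≤ c' v * x v)
    × (∀ v → ℓ v ≤ x v × x v ≤ ℕtoℚ (mult v))
    × (∀ e v → Eb e ≡ true → mem e v ≡ true → 0ℚ ≤ h e v × h e v ≤ x v)

  -- The feasible region of LP(E', ℓ, c') as a subset of ℚ^V × ℚ^(E×V):
  -- coordinates h_{e,v} that are not LP variables (e ∉ E' or v ∉ e) are fixed to 0.
  record Sol : Set where
    constructor sol
    field
      x : Fin n → ℚ
      h : Fin m → Fin n → ℚ
  open Sol public

  InRegion : (Eb : Fin m → Bool) (ℓ c' : Fin n → ℚ) → Sol → Set
  InRegion Eb ℓ c' p =
      LPFeasible Eb ℓ c' (x p) (h p)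
    × (∀ e v → (Eb e ∧ mem e v) ≡ false → h p e v ≡ 0ℚ)

  IsComb : ℚ → Sol → Sol → Sol → Set
  IsComb λ' p q r =
      (∀ v → x p v ≡ λ' * x q v + (1ℚ - λ') * x r v)
    × (∀ e v → h p e v ≡ λ' * h q e v + (1ℚ - λ') * h r e v)

  SameSol : Sol → Sol → Set
  SameSol q r = (∀ v → x q v ≡ x r v) × (∀ e v → h q e v ≡ h r e v)

  ExtremePoint : (Eb : Fin m → Bool) (ℓ c' : Fin n → ℚ) → Sol → Set
  ExtremePoint Eb ℓ c' p =
      InRegion Eb ℓ c' p
    × (∀ λ' q r → InRegion Eb ℓ c' q → InRegion Eb ℓ c' r →
         0ℚ < λ' → λ' < 1ℚ → IsComb λ' p q r → SameSol q r)

  BasicOptimal : (Eb : Fin m → Bool) (ℓ c' : Fin n → ℚ) → Sol → Set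
  BasicOptimal Eb ℓ c' p =
      ExtremePoint Eb ℓ c' p
    × (∀ q → InRegion Eb ℓ c' q → sumFin (x p) ≤ sumFin (x q))

  record State : Set where
    constructor state
    field
      𝓔  : Fin m → Bool
      h' : Fin m → Fin n → ℚ       -- assignment of folded edges
      ℓ  : Fin n → ℚ
      c' : Fin n → ℚ
  open State public

  initial : State
  initial = state allE (λ _ _ → 0ℚ) (λ _ → 0ℚ) c

  inI : Sol → Fin n → Bool
  inI p v = does (0ℚ <? x p v) ∧ does (x p v <? invℕ f)

  inT : State → Sol → Fin m → Fin n → Bool
  inT s p e v =
    𝓔 s e ∧ mem e v ∧ not (inI p v)
      ∧ does (0ℚ <? h p e v) ∧ does (h p e v ≟ x p v)

  Tne : State → Sol → Fin m → Bool
  Tne s p e = anyFin (inT s p e)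

  AllTEmpty : State → Sol → Set
  AllTEmpty s p = ∀ e → Tne s p e ≡ false

  ValidPick : State → Sol → (Fin m → Fin n) → Set
  ValidPick s p pick = ∀ e → Tne s p e ≡ true → inT s p e (pick e) ≡ true

  step : State → Sol → (Fin m → Fin n) → State
  step s p pick = state
    (λ e → 𝓔 s e ∧ not (Tne s p e))
    (λ e v → if Tne s p e ∧ does (v FinP.≟ pick e) then 1ℚ else h' s e v)
    (λ v → if anyFin (λ e → inT s p e v) then x p v else ℓ s v)
    (λ v → c' s v - sumFin (λ e → ind (inT s p e v) (d e)))

  -- Exec s k s_last p_last : starting from state s, the algorithm performs
  -- k iterations of Step 2; the last iteration starts in state s_last and
  -- computes the basic optimal solution p_last, after which it goes to Step 3.
  data Exec : State → ℕ → State → Sol → Set where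
    done : ∀ {s} p →
           BasicOptimal (𝓔 s) (ℓ s) (c' s) p →
           AllTEmpty s p →
           Exec s 1 s p
    iter : ∀ {s k sl pl} p (pick : Fin m → Fin n) →
           BasicOptimal (𝓔 s) (ℓ s) (c' s) p →
           ¬ AllTEmpty s p →
           ValidPick s p pick →
           Exec (step s p pick) k sl pl →
           Exec s (suc k) sl pl

  hTilde : State → Sol → Fin m → Fin n → ℚ
  hTilde sl pl e v = if 𝓔 sl e then h pl e v else h' sl e v

  ceilVec : Sol → Fin n → ℚ
  ceilVec pl v = ℤtoℚ ⌈ x pl v ⌉

-- Each iteration preserves an invariant: every folded edge is assigned entirely to one vertex u with ℓ_u > 0,
-- and at every vertex the load of the folded edges plus the residual capacity c' is at most c. The demand
-- subtracted from c'_v is at most c'_v, since each tight edge at v has h_{e,v} = x_v and so contributes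
-- d_e x_v to a load bounded by c'_v x_v. At the end the unfolded load at v is at most c'_v x_v ≤ c'_v ⌈x_v⌉,
-- and folded edges only meet vertices with x_v ≥ ℓ_v > 0, where ⌈x_v⌉ ≥ 1 bounds the folded load by itself
-- times ⌈x_v⌉; the invariant adds the two parts up to at most c_v ⌈x_v⌉.

module Submission where

open import Defs
open import Data.Nat using (ℕ; _≤_)
open import Data.Rational using (ℚ; 0ℚ)
open import Data.Fin using (Fin)
open import Data.Fin.Subset using (Subset)
open import Data.Product using (_×_; Σ)
open import Function.Definitions using (Injective)
open import Relation.Binary.PropositionalEquality using (_≡_)

open import Algebra.Bundles using (Ring)
import Algebra.Properties.Semiring.Sum as Sum
open import Data.Bool using (Bool; true; false; _∧_; not; if_then_else_)
open import Data.Bool.Properties using (∧-identityʳ; ∧-zeroʳ; not-injective)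
open import Data.Fin as Fin using (zero; suc)
import Data.Fin.Properties as Fin
open import Data.Integer as ℤ using (+_; -[1+_]; +[1+_])
open import Data.Integer.DivMod using (a≡a%n+[a/n]*n; n%d<d)
import Data.Integer.Properties as ℤP
open import Data.Integer.Tactic.RingSolver using (solve-∀)
import Data.Nat as ℕ
open import Data.Nat.Coprimality using (1-coprimeTo; sym)
open import Data.Product using (_,_; proj₁; proj₂)
open import Data.Sum using (_⊎_; inj₁; inj₂)
open import Data.Rational as ℚ using (mkℚ; ↥_; ↧_; 1ℚ; *≤*; *<*; _+_; _*_; _-_; _<_) renaming (ceiling to ⌈_⌉)
import Data.Rational.Properties as ℚP
open import Data.Rational.Solver using (module +-*-Solver)
open import Function using (_∘_)
open import Relation.Binary.PropositionalEquality as ≡ using (refl; cong; cong₂; subst; subst₂; _≢_)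
open import Relation.Nullary using (Dec; yes; no; does; contradiction)
open import Relation.Nullary.Decidable using (dec-true; dec-false)


↥-ℤtoℚ : ∀ k → ↥ ℤtoℚ k ≡ k
↥-ℤtoℚ (+ k)    = cong ↥_ (ℚP.normalize-coprime (sym (1-coprimeTo k)))
↥-ℤtoℚ -[1+ k ] = cong (λ q → ↥ (ℚ.- q)) (ℚP.normalize-coprime (sym (1-coprimeTo (ℕ.suc k))))

↧-ℤtoℚ : ∀ k → ↧ ℤtoℚ k ≡ + 1
↧-ℤtoℚ (+ k)    = cong ↧_ (ℚP.normalize-coprime (sym (1-coprimeTo k)))
↧-ℤtoℚ -[1+ k ] = cong (λ q → ↧ (ℚ.- q)) (ℚP.normalize-coprime (sym (1-coprimeTo (ℕ.suc k))))

≤-ℤtoℚ : ∀ {p k} → ↥ p ℤ.≤ k ℤ.* ↧ p → p ℚ.≤ ℤtoℚ k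
≤-ℤtoℚ {p} {k} le = *≤* (subst₂ ℤ._≤_ lhs rhs le)
  where
  lhs : ↥ p ≡ ↥ p ℤ.* ↧ ℤtoℚ k
  lhs = ≡.trans (≡.sym (ℤP.*-identityʳ (↥ p))) (cong (↥ p ℤ.*_) (≡.sym (↧-ℤtoℚ k)))
  rhs : k ℤ.* ↧ p ≡ ↥ ℤtoℚ k ℤ.* ↧ p
  rhs = cong (ℤ._* ↧ p) (≡.sym (↥-ℤtoℚ k))

ℤtoℚ-≤ : ∀ {p k} → p ℚ.≤ ℤtoℚ k → ↥ p ℤ.≤ k ℤ.* ↧ p
ℤtoℚ-≤ {p} {k} (*≤* le) = subst₂ ℤ._≤_ lhs rhs le
  where
  lhs : ↥ p ℤ.* ↧ ℤtoℚ k ≡ ↥ p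
  lhs = ≡.trans (cong (↥ p ℤ.*_) (↧-ℤtoℚ k)) (ℤP.*-identityʳ (↥ p))
  rhs : ↥ ℤtoℚ k ℤ.* ↧ p ≡ k ℤ.* ↧ p
  rhs = cong (ℤ._* ↧ p) (↥-ℤtoℚ k)

ℤtoℚ-mono-≤ : ∀ {k l} → k ℤ.≤ l → ℤtoℚ k ℚ.≤ ℤtoℚ l
ℤtoℚ-mono-≤ {k} {l} k≤l = ≤-ℤtoℚ {ℤtoℚ k} {l} (begin
  ↥ ℤtoℚ k          ≡⟨ ↥-ℤtoℚ k ⟩
  k                 ≤⟨ k≤l ⟩
  l                 ≡⟨ ℤP.*-identityʳ l ⟨
  l ℤ.* + 1         ≡⟨ cong (l ℤ.*_) (↧-ℤtoℚ k) ⟨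
  l ℤ.* ↧ ℤtoℚ k    ∎)
  where open ℤP.≤-Reasoning

-- ⌈ n / D ⌉ = - ⌊ - n / D ⌋, and writing - n = r + q D gives ⌈ n / D ⌉ D = n + r with 0 ≤ r < D.
ceilDiv-bounds : ∀ n D .{{_ : ℕ.NonZero D}} →
                 n ℤ.≤ ℤ.- ((ℤ.- n) ℤ./ + D) ℤ.* + D × ℤ.- ((ℤ.- n) ℤ./ + D) ℤ.* + D ℤ.< n ℤ.+ + D
ceilDiv-bounds n D = subst₂ ℤ._≤_ refl (≡.sym C*D≡n+r) (ℤP.i≤i+j n (+ r))
                   , subst₂ ℤ._<_ (≡.sym C*D≡n+r) refl (ℤP.+-monoʳ-< n (ℤ.+<+ (n%d<d (ℤ.- n) (+ D))))
  where
  q = (ℤ.- n) ℤ./ + D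
  r = (ℤ.- n) ℤ.% + D
  negate-division : ∀ r q d → ℤ.- q ℤ.* d ≡ ℤ.- (r ℤ.+ q ℤ.* d) ℤ.+ r
  negate-division = solve-∀
  C*D≡n+r : ℤ.- q ℤ.* + D ≡ n ℤ.+ + r
  C*D≡n+r = begin
    ℤ.- q ℤ.* + D               ≡⟨ negate-division (+ r) q (+ D) ⟩
    ℤ.- (+ r ℤ.+ q ℤ.* + D) ℤ.+ + r ≡⟨ cong (λ a → ℤ.- a ℤ.+ + r) (≡.sym (a≡a%n+[a/n]*n (ℤ.- n) (+ D))) ⟩
    ℤ.- (ℤ.- n) ℤ.+ + r          ≡⟨ cong (ℤ._+ + r) (ℤP.neg-involutive n) ⟩
    n ℤ.+ + r                    ∎
    where open ≡.≡-Reasoning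

ceiling-bounds : ∀ p → ↥ p ℤ.≤ ⌈ p ⌉ ℤ.* ↧ p × ⌈ p ⌉ ℤ.* ↧ p ℤ.< ↥ p ℤ.+ ↧ p
ceiling-bounds (mkℚ (+ 0)      d-1 _) = ceilDiv-bounds (+ 0) (ℕ.suc d-1)
ceiling-bounds (mkℚ +[1+ k ]   d-1 _) = ceilDiv-bounds +[1+ k ] (ℕ.suc d-1)
ceiling-bounds (mkℚ -[1+ k ]   d-1 _) = ceilDiv-bounds -[1+ k ] (ℕ.suc d-1)

≤-ceiling : ∀ p → p ℚ.≤ ℤtoℚ ⌈ p ⌉
≤-ceiling p = ≤-ℤtoℚ {p} {⌈ p ⌉} (proj₁ (ceiling-bounds p))

ceiling-least : ∀ p k → p ℚ.≤ ℤtoℚ k → ℤtoℚ ⌈ p ⌉ ℚ.≤ ℤtoℚ k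
ceiling-least p k p≤k = ℤtoℚ-mono-≤ {⌈ p ⌉} {k} (subst₂ ℤ._≤_ refl (ℤP.pred-suc k)
  (ℤP.i<j⇒i≤pred[j] {j = ℤ.suc k} (ℤP.*-cancelʳ-<-nonNeg (↧ p) ⌈p⌉D<[k+1]D)))
  where
  open ℤP.≤-Reasoning
  ⌈p⌉D<[k+1]D : ⌈ p ⌉ ℤ.* ↧ p ℤ.< ℤ.suc k ℤ.* ↧ p
  ⌈p⌉D<[k+1]D = begin-strict
    ⌈ p ⌉ ℤ.* ↧ p       <⟨ proj₂ (ceiling-bounds p) ⟩
    ↥ p ℤ.+ ↧ p         ≤⟨ ℤP.+-monoˡ-≤ (↧ p) (ℤtoℚ-≤ {p} {k} p≤k) ⟩
    k ℤ.* ↧ p ℤ.+ ↧ p   ≡⟨ ℤP.+-comm (k ℤ.* ↧ p) (↧ p) ⟩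
    ↧ p ℤ.+ k ℤ.* ↧ p   ≡⟨ ℤP.suc-* k (↧ p) ⟨
    ℤ.suc k ℤ.* ↧ p     ∎

ceiling-pos : ∀ p → 0ℚ ℚ.< p → 1ℚ ℚ.≤ ℤtoℚ ⌈ p ⌉
ceiling-pos p@(mkℚ n _ _) (*<* 0<n*1) = ℤtoℚ-mono-≤ {+ 1} {⌈ p ⌉} (ℤP.i<j⇒suc[i]≤j 0<⌈p⌉)
  where
  open ℤP.≤-Reasoning
  0<⌈p⌉ : + 0 ℤ.< ⌈ p ⌉
  0<⌈p⌉ = ℤP.*-cancelʳ-<-nonNeg (↧ p) (begin-strict
    + 0 ℤ.* ↧ p     ≡⟨⟩
    + 0             <⟨ subst₂ ℤ._<_ refl (ℤP.*-identityʳ n) 0<n*1 ⟩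
    n               ≤⟨ proj₁ (ceiling-bounds p) ⟩
    ⌈ p ⌉ ℤ.* ↧ p   ∎)

*-monoʳ-≤-0≤ : ∀ {r p q} → 0ℚ ℚ.≤ r → p ℚ.≤ q → p * r ℚ.≤ q * r
*-monoʳ-≤-0≤ {r} 0≤r = ℚP.*-monoʳ-≤-nonNeg r {{ℚ.nonNegative 0≤r}}

*-monoˡ-≤-0≤ : ∀ {r p q} → 0ℚ ℚ.≤ r → p ℚ.≤ q → r * p ℚ.≤ r * q
*-monoˡ-≤-0≤ {r} 0≤r = ℚP.*-monoˡ-≤-nonNeg r {{ℚ.nonNegative 0≤r}}

p≤p+q : ∀ {p q} → 0ℚ ℚ.≤ q → p ℚ.≤ p + q
p≤p+q {p} {q} 0≤q = subst (ℚ._≤ p + q) (ℚP.+-identityʳ p) (ℚP.+-monoʳ-≤ p 0≤q)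

q≤p+q : ∀ {p q} → 0ℚ ℚ.≤ p → q ℚ.≤ p + q
q≤p+q {p} {q} 0≤p = subst (q ℚ.≤_) (ℚP.+-comm q p) (p≤p+q 0≤p)

0≤* : ∀ {p q} → 0ℚ ℚ.≤ p → 0ℚ ℚ.≤ q → 0ℚ ℚ.≤ p * q
0≤* {p} {q} 0≤p 0≤q = subst (ℚ._≤ p * q) (ℚP.*-zeroʳ p) (*-monoˡ-≤-0≤ 0≤p 0≤q)

+-cancel-middle : ∀ p q r → (p + q) + (r - q) ≡ p + r
+-cancel-middle = solve 3 (λ p q r → (p :+ q) :+ (r :- q) := p :+ r) refl
  where open +-*-Solver

p≤q⇒0≤q-p : ∀ {p q} → p ℚ.≤ q → 0ℚ ℚ.≤ q - p
p≤q⇒0≤q-p {p} {q} p≤q = subst (ℚ._≤ q - p) (ℚP.+-inverseʳ p) (ℚP.+-monoˡ-≤ (ℚ.- p) p≤q)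

ind-0 : ∀ b → ind b 0ℚ ≡ 0ℚ
ind-0 true  = refl
ind-0 false = refl

ind-nonNeg : ∀ b {q} → 0ℚ ℚ.≤ q → 0ℚ ℚ.≤ ind b q
ind-nonNeg true  0≤q = 0≤q
ind-nonNeg false _   = ℚP.≤-refl

∧-true⁻ : ∀ a {b} → a ∧ b ≡ true → a ≡ true × b ≡ true
∧-true⁻ true refl = refl , refl

does-true⇒ : ∀ {A : Set} (a? : Dec A) → does a? ≡ true → A
does-true⇒ (yes a) _ = a

anyFin-true : ∀ {k} (g : Fin k → Bool) i → g i ≡ true → anyFin g ≡ true
anyFin-true g zero    gi≡true rewrite gi≡true = refl
anyFin-true g (suc i) gi≡true with g zero
... | true  = refl
... | false = anyFin-true (g ∘ suc) i gi≡true

anyFin-false : ∀ {k} (g : Fin k → Bool) → (∀ i → g i ≡ false) → anyFin g ≡ false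
anyFin-false {ℕ.zero}  g _      = refl
anyFin-false {ℕ.suc k} g g≡false rewrite g≡false zero = anyFin-false (g ∘ suc) (g≡false ∘ suc)

module ∑ = Sum (Ring.semiring ℚP.+-*-ring)

sumFin≡sum : ∀ {k} (g : Fin k → ℚ) → sumFin g ≡ ∑.sum g
sumFin≡sum {ℕ.zero}  g = refl
sumFin≡sum {ℕ.suc k} g = cong (λ t → g zero + t) (sumFin≡sum (g ∘ suc))

sumFin-+ : ∀ {k} (g g′ : Fin k → ℚ) → sumFin (λ i → g i + g′ i) ≡ sumFin g + sumFin g′
sumFin-+ g g′ = begin
  sumFin (λ i → g i + g′ i)    ≡⟨ sumFin≡sum (λ i → g i + g′ i) ⟩
  ∑.sum (λ i → g i + g′ i)     ≡⟨ ∑.∑-distrib-+ g g′ ⟩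
  ∑.sum g + ∑.sum g′           ≡⟨ cong₂ _+_ (sumFin≡sum g) (sumFin≡sum g′) ⟨
  sumFin g + sumFin g′         ∎
  where open ≡.≡-Reasoning

sumFin-*ʳ : ∀ {k} (g : Fin k → ℚ) r → sumFin (λ i → g i * r) ≡ sumFin g * r
sumFin-*ʳ g r = begin
  sumFin (λ i → g i * r)   ≡⟨ sumFin≡sum (λ i → g i * r) ⟩
  ∑.sum (λ i → g i * r)    ≡⟨ ∑.*-distribʳ-sum r g ⟨
  ∑.sum g * r              ≡⟨ cong (_* r) (sumFin≡sum g) ⟨
  sumFin g * r             ∎
  where open ≡.≡-Reasoning

sumFin-mono : ∀ {k} {g g′ : Fin k → ℚ} → (∀ i → g i ℚ.≤ g′ i) → sumFin g ℚ.≤ sumFin g′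
sumFin-mono {ℕ.zero}  _   = ℚP.≤-refl
sumFin-mono {ℕ.suc k} g≤g′ = ℚP.+-mono-≤ (g≤g′ zero) (sumFin-mono (g≤g′ ∘ suc))

sumFin-cong : ∀ {k} {g g′ : Fin k → ℚ} → (∀ i → g i ≡ g′ i) → sumFin g ≡ sumFin g′
sumFin-cong {g = g} {g′} g≗g′ = ≡.trans (sumFin≡sum g) (≡.trans (∑.sum-cong-≗ g≗g′) (≡.sym (sumFin≡sum g′)))

sumFin-zero : ∀ {k} {g : Fin k → ℚ} → (∀ i → g i ≡ 0ℚ) → sumFin g ≡ 0ℚ
sumFin-zero {k} g≡0 = ≡.trans (sumFin-cong g≡0) (sumFin-zero-const k)
  where
  sumFin-zero-const : ∀ k → sumFin {k} (λ _ → 0ℚ) ≡ 0ℚ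
  sumFin-zero-const k = ≡.trans (sumFin≡sum {k} _) (∑.sum-replicate-zero k)

sumFin-unit : ∀ {k} (g : Fin k → ℚ) u → g u ≡ 1ℚ → (∀ i → i ≢ u → g i ≡ 0ℚ) → sumFin g ≡ 1ℚ
sumFin-unit g zero    g0≡1 g≡0 =
  ≡.trans (cong₂ _+_ g0≡1 (sumFin-zero λ i → g≡0 (suc i) λ ())) (ℚP.+-identityʳ 1ℚ)
sumFin-unit g (suc u) gu≡1 g≡0 =
  ≡.trans (cong₂ _+_ (g≡0 zero λ ()) (sumFin-unit (g ∘ suc) u gu≡1 λ i i≢u → g≡0 (suc i) (i≢u ∘ Fin.suc-injective)))
          (ℚP.+-identityˡ 1ℚ)

module TightVCHC (n m : ℕ) (edge : Fin m → Subset n)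
                 (d : Fin m → ℚ) (c : Fin n → ℚ) (mult : Fin n → ℕ)
                 (0≤d : ∀ e → 0ℚ ℚ.≤ d e) (0≤c : ∀ v → 0ℚ ℚ.≤ c v) where
  open VCHC n m edge d c mult

  foldedLoad : State → Fin n → ℚ
  foldedLoad s = load (not ∘ 𝓔 s) (h' s)

  load-split : ∀ (E : Fin m → Bool) (h₁ h₂ : Fin m → Fin n → ℚ) v →
               load allE (λ e w → if E e then h₁ e w else h₂ e w) v ≡ load E h₁ v + load (not ∘ E) h₂ v
  load-split E h₁ h₂ v = ≡.trans (sumFin-cong split-term) (sumFin-+ {m} _ _)
    where
    split-term : ∀ e → ind (mem e v) (d e * (if E e then h₁ e v else h₂ e v))
                     ≡ ind (E e ∧ mem e v) (d e * h₁ e v) + ind (not (E e) ∧ mem e v) (d e * h₂ e v)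
    split-term e with E e | mem e v
    ... | true  | true  = ≡.sym (ℚP.+-identityʳ _)
    ... | true  | false = ≡.sym (ℚP.+-identityʳ _)
    ... | false | true  = ≡.sym (ℚP.+-identityˡ _)
    ... | false | false = ≡.sym (ℚP.+-identityˡ _)

  record Folded (s : State) (e : Fin m) : Set where
    field
      vertex   : Fin n
      vertex∈e : mem e vertex ≡ true
      0<ℓ      : 0ℚ < ℓ s vertex
      h'-at    : h' s e vertex ≡ 1ℚ
      h'-off   : ∀ v → v ≢ vertex → h' s e v ≡ 0ℚ

  record Invariant (s : State) : Set where
    field
      folded         : ∀ e → 𝓔 s e ≡ false → Folded s e
      h'-unfolded    : ∀ e v → 𝓔 s e ≡ true → h' s e v ≡ 0ℚ
      capacity-split : ∀ v → foldedLoad s v + c' s v ℚ.≤ c v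
      0≤c'           : ∀ v → 0ℚ ℚ.≤ c' s v
      0≤ℓ            : ∀ v → 0ℚ ℚ.≤ ℓ s v

  H'Value : State → Fin m → Fin n → Set
  H'Value s e v = h' s e v ≡ 0ℚ ⊎ (h' s e v ≡ 1ℚ × 0ℚ < ℓ s v)

  folded-h'-value : ∀ {s e} → Folded s e → ∀ v → H'Value s e v
  folded-h'-value F v with v Fin.≟ Folded.vertex F
  ... | yes refl = inj₂ (Folded.h'-at F , Folded.0<ℓ F)
  ... | no  v≢u  = inj₁ (Folded.h'-off F v v≢u)

  h'-value : ∀ {s} → Invariant s → ∀ e v → H'Value s e v
  h'-value {s} inv e v with 𝓔 s e in E
  ... | true  = inj₁ (Invariant.h'-unfolded inv e v E)
  ... | false = folded-h'-value (Invariant.folded inv e E) v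

  0≤h' : ∀ {s} → Invariant s → ∀ e v → 0ℚ ℚ.≤ h' s e v
  0≤h' inv e v with h'-value inv e v
  ... | inj₁ h'≡0       = ℚP.≤-reflexive (≡.sym h'≡0)
  ... | inj₂ (h'≡1 , _) = subst (0ℚ ℚ.≤_) (≡.sym h'≡1) (ℚP.nonNegative⁻¹ 1ℚ)

  initial-invariant : Invariant initial
  initial-invariant = record
    { folded         = λ _ ()
    ; h'-unfolded    = λ _ _ _ → refl
    ; capacity-split = λ v → ℚP.≤-reflexive (≡.trans (cong (_+ c v) (sumFin-zero {m} λ _ → refl)) (ℚP.+-identityˡ (c v)))
    ; 0≤c'           = 0≤c
    ; 0≤ℓ            = λ _ → ℚP.≤-refl
    }

  module Step (s : State) (p : Sol) (pick : Fin m → Fin n) (inv : Invariant s)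
              (lp : LPFeasible (𝓔 s) (ℓ s) (c' s) (x p) (h p)) (valid : ValidPick s p pick) where
    open Invariant inv

    s′ : State
    s′ = step s p pick

    capacity : ∀ v → load (𝓔 s) (h p) v ℚ.≤ c' s v * x p v
    capacity = proj₁ (proj₂ lp)

    bounds : ∀ v → ℓ s v ℚ.≤ x p v × x p v ℚ.≤ ℕtoℚ (mult v)
    bounds = proj₁ (proj₂ (proj₂ lp))

    h-bounds : ∀ e v → 𝓔 s e ≡ true → mem e v ≡ true → 0ℚ ℚ.≤ h p e v × h p e v ℚ.≤ x p v
    h-bounds = proj₂ (proj₂ (proj₂ lp))

    tight-spec : ∀ e v → inT s p e v ≡ true →
                 𝓔 s e ≡ true × mem e v ≡ true × 0ℚ < h p e v × h p e v ≡ x p v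
    tight-spec e v t
      with tE , t₁    ← ∧-true⁻ (𝓔 s e) t
      with tM , t₂    ← ∧-true⁻ (mem e v) t₁
      with _  , t₃    ← ∧-true⁻ (not (inI p v)) t₂
      with t₄ , h≡x   ← ∧-true⁻ (does (0ℚ ℚP.<? h p e v)) t₃
      = tE , tM , does-true⇒ (0ℚ ℚP.<? h p e v) t₄ , does-true⇒ (h p e v ℚP.≟ x p v) h≡x

    0≤x : ∀ v → 0ℚ ℚ.≤ x p v
    0≤x v = ℚP.≤-trans (0≤ℓ v) (proj₁ (bounds v))

    0≤load-term : ∀ e v → 0ℚ ℚ.≤ ind (𝓔 s e ∧ mem e v) (d e * h p e v)
    0≤load-term e v with 𝓔 s e in E | mem e v in M
    ... | true  | true  = 0≤* (0≤d e) (proj₁ (h-bounds e v E M))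
    ... | true  | false = ℚP.≤-refl
    ... | false | _     = ℚP.≤-refl

    tightDemand : Fin n → ℚ
    tightDemand v = sumFin (λ e → ind (inT s p e v) (d e))

    tight-term : ∀ e v → ind (inT s p e v) (d e) * x p v ℚ.≤ ind (𝓔 s e ∧ mem e v) (d e * h p e v)
    tight-term e v with inT s p e v in t
    ... | false = subst (ℚ._≤ ind (𝓔 s e ∧ mem e v) (d e * h p e v)) (≡.sym (ℚP.*-zeroˡ (x p v))) (0≤load-term e v)
    ... | true with tE , tM , _ , h≡x ← tight-spec e v t rewrite tE | tM | h≡x = ℚP.≤-refl

    tightDemand≤c' : ∀ v → tightDemand v ℚ.≤ c' s v
    tightDemand≤c' v with x p v ℚP.≤? 0ℚ
    ... | yes x≤0 = subst (ℚ._≤ c' s v) (≡.sym (sumFin-zero {m} no-tight-edge)) (0≤c' v)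
      where
      x≡0 : x p v ≡ 0ℚ
      x≡0 = ℚP.≤-antisym x≤0 (0≤x v)
      no-tight-edge : ∀ e → ind (inT s p e v) (d e) ≡ 0ℚ
      no-tight-edge e with inT s p e v in t
      ... | false = refl
      ... | true with _ , _ , 0<h , h≡x ← tight-spec e v t =
        contradiction (subst (0ℚ <_) (≡.trans h≡x x≡0) 0<h) (ℚP.<-irrefl refl)
    ... | no x≰0 = ℚP.*-cancelʳ-≤-pos (x p v) {{ℚ.positive (ℚP.≰⇒> x≰0)}} (begin
      tightDemand v * x p v                                ≡⟨ sumFin-*ʳ (λ e → ind (inT s p e v) (d e)) (x p v) ⟨
      sumFin (λ e → ind (inT s p e v) (d e) * x p v)       ≤⟨ sumFin-mono (λ e → tight-term e v) ⟩
      load (𝓔 s) (h p) v                                   ≤⟨ capacity v ⟩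
      c' s v * x p v                                       ∎)
      where open ℚP.≤-Reasoning

    Tne-false : ∀ e → 𝓔 s e ≡ false → Tne s p e ≡ false
    Tne-false e E = anyFin-false (inT s p e) (λ v → cong (_∧ _) E)

    ℓ-step : ∀ v → ℓ s v ℚ.≤ ℓ s′ v
    ℓ-step v with anyFin (λ e → inT s p e v)
    ... | true  = proj₁ (bounds v)
    ... | false = ℚP.≤-refl

    folded-kept : ∀ e → 𝓔 s e ≡ false → Folded s′ e
    folded-kept e E = record
      { vertex   = vertex
      ; vertex∈e = vertex∈e
      ; 0<ℓ      = ℚP.<-≤-trans 0<ℓ (ℓ-step vertex)
      ; h'-at    = ≡.trans (h'-kept vertex) h'-at
      ; h'-off   = λ w w≢u → ≡.trans (h'-kept w) (h'-off w w≢u)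
      }
      where
      open Folded (folded e E)
      h'-kept : ∀ w → h' s′ e w ≡ h' s e w
      h'-kept w = cong (λ b → if b ∧ does (w Fin.≟ pick e) then 1ℚ else h' s e w) (Tne-false e E)

    folded-new : ∀ e → Tne s p e ≡ true → Folded s′ e
    folded-new e T = record
      { vertex   = u
      ; vertex∈e = u∈e
      ; 0<ℓ      = subst (0ℚ <_) (≡.sym ℓ′u≡xu) (subst (0ℚ <_) hu≡xu 0<hu)
      ; h'-at    = ≡.trans (h'-new u) (cong (if_then 1ℚ else h' s e u) (dec-true (u Fin.≟ u) refl))
      ; h'-off   = λ w w≢u → ≡.trans (h'-new w)
                     (≡.trans (cong (if_then 1ℚ else h' s e w) (dec-false (w Fin.≟ u) w≢u)) (h'-unfolded e w E))
      }
      where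
      u = pick e
      u-tight = valid e T
      spec = tight-spec e u u-tight
      E = proj₁ spec
      u∈e = proj₁ (proj₂ spec)
      0<hu = proj₁ (proj₂ (proj₂ spec))
      hu≡xu = proj₂ (proj₂ (proj₂ spec))
      ℓ′u≡xu : ℓ s′ u ≡ x p u
      ℓ′u≡xu = cong (if_then x p u else ℓ s u) (anyFin-true (λ e′ → inT s p e′ u) e u-tight)
      h'-new : ∀ w → h' s′ e w ≡ (if does (w Fin.≟ u) then 1ℚ else h' s e w)
      h'-new w = cong (λ b → if b ∧ does (w Fin.≟ u) then 1ℚ else h' s e w) T

    folded-step : ∀ e → 𝓔 s e ∧ not (Tne s p e) ≡ false → Folded s′ e
    folded-step e E′ with Tne s p e in T
    ... | true  = folded-new e T
    ... | false = folded-kept e (≡.trans (≡.sym (∧-identityʳ (𝓔 s e))) E′)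

    tight≤folded+tight : ∀ e v → ind (inT s p e v) (d e) ℚ.≤ ind (not (𝓔 s e) ∧ mem e v) (d e * h' s e v) + ind (inT s p e v) (d e)
    tight≤folded+tight e v = q≤p+q (ind-nonNeg (not (𝓔 s e) ∧ mem e v) (0≤* (0≤d e) (0≤h' inv e v)))

    folded-term-step : ∀ e v →
      ind (not (𝓔 s e ∧ not (Tne s p e)) ∧ mem e v) (d e * (if Tne s p e ∧ does (v Fin.≟ pick e) then 1ℚ else h' s e v))
        ℚ.≤ ind (not (𝓔 s e) ∧ mem e v) (d e * h' s e v) + ind (inT s p e v) (d e)
    folded-term-step e v with Tne s p e in T
    ... | false rewrite ∧-identityʳ (𝓔 s e) = p≤p+q (ind-nonNeg (inT s p e v) (0≤d e))
    ... | true rewrite ∧-zeroʳ (𝓔 s e) with tight-spec e (pick e) (valid e T) | v Fin.≟ pick e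
    ...   | E , _ , _ | no _ = begin
      ind (mem e v) (d e * h' s e v)  ≡⟨ cong (λ q → ind (mem e v) (d e * q)) (h'-unfolded e v E) ⟩
      ind (mem e v) (d e * 0ℚ)        ≡⟨ ≡.trans (cong (ind (mem e v)) (ℚP.*-zeroʳ (d e))) (ind-0 (mem e v)) ⟩
      0ℚ                              ≤⟨ ind-nonNeg (inT s p e v) (0≤d e) ⟩
      ind (inT s p e v) (d e)         ≤⟨ tight≤folded+tight e v ⟩
      _                               ∎
      where open ℚP.≤-Reasoning
    ...   | _ , v∈e , _ | yes refl = begin
      ind (mem e v) (d e * 1ℚ)        ≡⟨ cong₂ ind v∈e (ℚP.*-identityʳ (d e)) ⟩
      d e                             ≡⟨ cong (λ b → ind b (d e)) (valid e T) ⟨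
      ind (inT s p e v) (d e)         ≤⟨ tight≤folded+tight e v ⟩
      _                               ∎
      where open ℚP.≤-Reasoning

    foldedLoad-step : ∀ v → foldedLoad s′ v ℚ.≤ foldedLoad s v + tightDemand v
    foldedLoad-step v = ℚP.≤-trans (sumFin-mono (λ e → folded-term-step e v)) (ℚP.≤-reflexive (sumFin-+ {m} _ _))

    invariant-step : Invariant s′
    invariant-step = record
      { folded         = folded-step
      ; h'-unfolded    = h'-unfolded′
      ; capacity-split = λ v → begin
          foldedLoad s′ v + (c' s v - tightDemand v)                   ≤⟨ ℚP.+-monoˡ-≤ (c' s v - tightDemand v) (foldedLoad-step v) ⟩
          (foldedLoad s v + tightDemand v) + (c' s v - tightDemand v)  ≡⟨ +-cancel-middle (foldedLoad s v) (tightDemand v) (c' s v) ⟩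
          foldedLoad s v + c' s v                                      ≤⟨ capacity-split v ⟩
          c v                                                          ∎
      ; 0≤c'           = λ v → p≤q⇒0≤q-p (tightDemand≤c' v)
      ; 0≤ℓ            = λ v → ℚP.≤-trans (0≤ℓ v) (ℓ-step v)
      }
      where
      open ℚP.≤-Reasoning
      h'-unfolded′ : ∀ e v → 𝓔 s e ∧ not (Tne s p e) ≡ true → h' s′ e v ≡ 0ℚ
      h'-unfolded′ e v E′ with E , ¬T ← ∧-true⁻ (𝓔 s e) E′ =
        ≡.trans (cong (λ b → if b ∧ does (v Fin.≟ pick e) then 1ℚ else h' s e v) (not-injective ¬T))
                (h'-unfolded e v E)

  lpFeasible : ∀ {s p} → BasicOptimal (𝓔 s) (ℓ s) (c' s) p → LPFeasible (𝓔 s) (ℓ s) (c' s) (x p) (h p)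
  lpFeasible (((lp , _) , _) , _) = lp

  exec-invariant : ∀ {s k sl pl} → Invariant s → Exec s k sl pl →
                   Invariant sl × LPFeasible (𝓔 sl) (ℓ sl) (c' sl) (x pl) (h pl)
  exec-invariant {s} inv (done p opt _)                 = inv , lpFeasible {s} opt
  exec-invariant {s} inv (iter p pick opt _ valid rest) =
    exec-invariant (Step.invariant-step s p pick inv (lpFeasible {s} opt) valid) rest

  rounding-feasible : ∀ {s p} → Invariant s → LPFeasible (𝓔 s) (ℓ s) (c' s) (x p) (h p) →
                      LPFeasible allE (λ _ → 0ℚ) c (ceilVec p) (hTilde s p)
  rounding-feasible {s} {p} inv (rows , capacity , bounds , h-bounds) = rows′ , capacity′ , bounds′ , h-bounds′
    where
    open Invariant inv
    open ℚP.≤-Reasoning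

    X : Fin n → ℚ
    X = ceilVec p

    x≤X : ∀ v → x p v ℚ.≤ X v
    x≤X v = ≤-ceiling (x p v)

    0≤X : ∀ v → 0ℚ ℚ.≤ X v
    0≤X v = ℚP.≤-trans (ℚP.≤-trans (0≤ℓ v) (proj₁ (bounds v))) (x≤X v)

    1≤X : ∀ v → 0ℚ < ℓ s v → 1ℚ ℚ.≤ X v
    1≤X v 0<ℓ = ceiling-pos (x p v) (ℚP.<-≤-trans 0<ℓ (proj₁ (bounds v)))

    h'≤X : ∀ e v → h' s e v ℚ.≤ X v
    h'≤X e v with h'-value inv e v
    ... | inj₁ h'≡0         = subst (ℚ._≤ X v) (≡.sym h'≡0) (0≤X v)
    ... | inj₂ (h'≡1 , 0<ℓ) = subst (ℚ._≤ X v) (≡.sym h'≡1) (1≤X v 0<ℓ)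

    h'≤h'*X : ∀ e v → h' s e v ℚ.≤ h' s e v * X v
    h'≤h'*X e v with h'-value inv e v
    ... | inj₁ h'≡0         rewrite h'≡0 = ℚP.≤-reflexive (≡.sym (ℚP.*-zeroˡ (X v)))
    ... | inj₂ (h'≡1 , 0<ℓ) rewrite h'≡1 = subst (1ℚ ℚ.≤_) (≡.sym (ℚP.*-identityˡ (X v))) (1≤X v 0<ℓ)

    folded-term≤*X : ∀ e v → ind (not (𝓔 s e) ∧ mem e v) (d e * h' s e v) ℚ.≤ ind (not (𝓔 s e) ∧ mem e v) (d e * h' s e v) * X v
    folded-term≤*X e v with not (𝓔 s e) ∧ mem e v
    ... | false = ℚP.≤-reflexive (≡.sym (ℚP.*-zeroˡ (X v)))
    ... | true  = begin
      d e * h' s e v           ≤⟨ *-monoˡ-≤-0≤ (0≤d e) (h'≤h'*X e v) ⟩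
      d e * (h' s e v * X v)   ≡⟨ ℚP.*-assoc (d e) (h' s e v) (X v) ⟨
      d e * h' s e v * X v     ∎

    foldedLoad≤foldedLoad*X : ∀ v → foldedLoad s v ℚ.≤ foldedLoad s v * X v
    foldedLoad≤foldedLoad*X v = ℚP.≤-trans (sumFin-mono (λ e → folded-term≤*X e v)) (ℚP.≤-reflexive (sumFin-*ʳ {m} _ (X v)))

    rows′ : ∀ e → allE e ≡ true → sumFin (λ v → ind (mem e v) (hTilde s p e v)) ≡ 1ℚ
    rows′ e _ with 𝓔 s e in E
    ... | true  = rows e E
    ... | false = sumFin-unit _ vertex (≡.trans (cong (λ b → ind b (h' s e vertex)) vertex∈e) h'-at)
                    λ w w≢u → ≡.trans (cong (ind (mem e w)) (h'-off w w≢u)) (ind-0 (mem e w))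
      where open Folded (folded e E)

    capacity′ : ∀ v → load allE (hTilde s p) v ℚ.≤ c v * X v
    capacity′ v = begin
      load allE (hTilde s p) v                       ≡⟨ load-split (𝓔 s) (h p) (h' s) v ⟩
      load (𝓔 s) (h p) v + foldedLoad s v            ≤⟨ ℚP.+-mono-≤ (capacity v) (foldedLoad≤foldedLoad*X v) ⟩
      c' s v * x p v + foldedLoad s v * X v          ≤⟨ ℚP.+-monoˡ-≤ (foldedLoad s v * X v) (*-monoˡ-≤-0≤ (0≤c' v) (x≤X v)) ⟩
      c' s v * X v + foldedLoad s v * X v            ≡⟨ ℚP.*-distribʳ-+ (X v) (c' s v) (foldedLoad s v) ⟨
      (c' s v + foldedLoad s v) * X v                ≡⟨ cong (_* X v) (ℚP.+-comm (c' s v) (foldedLoad s v)) ⟩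
      (foldedLoad s v + c' s v) * X v                ≤⟨ *-monoʳ-≤-0≤ (0≤X v) (capacity-split v) ⟩
      c v * X v                                      ∎

    bounds′ : ∀ v → 0ℚ ℚ.≤ X v × X v ℚ.≤ ℕtoℚ (mult v)
    bounds′ v = 0≤X v , ceiling-least (x p v) (+ mult v) (proj₂ (bounds v))

    h-bounds′ : ∀ e v → allE e ≡ true → mem e v ≡ true → 0ℚ ℚ.≤ hTilde s p e v × hTilde s p e v ℚ.≤ X v
    h-bounds′ e v _ v∈e with 𝓔 s e in E
    ... | true  =
      proj₁ (h-bounds e v E v∈e) , ℚP.≤-trans (proj₂ (h-bounds e v E v∈e)) (x≤X v)
    ... | false = 0≤h' inv e v , h'≤X e v

lemma3 : (n m : ℕ) (edge : Fin m → Subset n)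
         (d : Fin m → ℚ) (c : Fin n → ℚ) (mult : Fin n → ℕ) →
         Injective _≡_ _≡_ edge →
         (∀ e → 0ℚ Data.Rational.≤ d e) →
         (∀ v → 0ℚ Data.Rational.≤ c v) →
         2 ≤ VCHC.f n m edge d c mult →
         Σ (Fin m → Fin n → ℚ) (VCHC.FeasibleAssignment n m edge d c mult) →
         ∀ k (sl : VCHC.State n m edge d c mult) (pl : VCHC.Sol n m edge d c mult) →
         VCHC.Exec n m edge d c mult (VCHC.initial n m edge d c mult) k sl pl →
         VCHC.LPFeasible n m edge d c mult
           (VCHC.allE n m edge d c mult) (λ _ → 0ℚ) c
           (VCHC.ceilVec n m edge d c mult pl)
           (VCHC.hTilde n m edge d c mult sl pl)
lemma3 n m edge d c mult _ 0≤d 0≤c _ _ k sl pl run =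
  let inv , lp = exec-invariant initial-invariant run in rounding-feasible inv lp
  where open TightVCHC n m edge d c mult 0≤d 0≤c
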